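{- Let $F$ be a set, $\mathcal D$ a filter on $F$, and $\psi,\xi$ formulas of $L(\Sigma_2^g)$ that are infrafiltrated with respect to $\mathcal D$. Then $\psi\land\xi$ is infrafiltrated with respect to $\mathcal D$.
   Context: Types: $0$ is the first-order type; for $k\ge0$, $[\tau_0,\ldots,\tau_k]$ with all $\tau_\mu=0$ is a second-order type; for a set $A$, $0(A)=A$, $\check\tau(A)=A^{k+1}$, $\tau(A)=\mathcal P(A^{k+1})$. A generalized second-order signature $\Sigma_2^g$ has a set $\Theta$ of such types (containing $0$ and some second-order type), $\Theta_b$ its second-order types, constant symbols $\sigma^\tau_\omega$, binary predicate symbols $\delta_\tau$ ($\tau\in\Theta$), $\varepsilon_\tau$ ($\tau\in\Theta_b$), and variables of each type; formulas of $L(\Sigma_2^g)$ are built from atomic formulas $q\,\delta_\tau\,r$, $(q_0,\ldots,q_k)\,\varepsilon_\tau\,r$ with $\lnot,\land,\lor,\Rightarrow,\exists,\forall$. A system $U=\langle A,S\rangle$: set $A$, constants $s^\tau_\omega\in\tau(A)$, $\approx_\tau\subseteq\tau(A)^2$ containing identity, $\tilde\in_\tau\subseteq\check\tau(A)\times\tau(A)$ containing membership; satisfaction $U\vDash\varphi[\gamma]$ under an evaluation $\gamma$ (with $\gamma(x^\tau)\in\tau(A)$) interprets $\delta_\tau$ by $\approx_\tau$, $\varepsilon_\tau$ by $\tilde\in_\tau$, connectives as usual, and quantifiers over all of $\tau(A)$. $U$ has true generalized equalities and belongings if each $\approx_\tau$ is an equivalence relation and $x_\mu\approx y_\mu$,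 $u\approx_\tau v$ imply $((x_\mu)\mathrel{\tilde\in_\tau}u\Leftrightarrow(y_\mu)\mathrel{\tilde\in_\tau}v)$. Infra-$\mathcal D$-product $\mathrm{Inf}_{\mathcal D}\prod_fU_f$ of $U_f=\langle A_f,S_f\rangle$: support $A=\prod_fA_f$; $p(f)(\mu)=p(\mu)(f)$; $P\langle f\rangle=\{p(f):p\in P\}$; constants $s^0_\omega(f)=s^0_{\omega f}$, $s^\tau_\omega=\{p:\forall f\ p(f)\in s^\tau_{\omega f}\}$; $p\approx_0q$ iff $\exists G\in\mathcal D\,\forall g\in G\ p(g)\approx_{0,g}q(g)$; $P\approx_\tau Q$ iff $\exists G\in\mathcal D\,\forall g\in G\ P\langle g\rangle\approx_{\tau,g}Q\langle g\rangle$; $p\mathrel{\tilde\in_\tau}P$ iff $\exists G\in\mathcal D\,\forall g\in G\ p(g)\mathrel{\tilde\in_{\tau,g}}P\langle g\rangle$. Crossing $\bowtie_f\gamma_f$: $\gamma(x)(f)=\gamma_f(x)$ for type $0$, $\gamma(x)=\{p:\forall f\ p(f)\in\gamma_f(x)\}$ otherwise. $\varphi$ is infrafiltrated with respect to $\mathcal D$ if for every collection $(\langle U_f,\gamma_f\rangle)_{f\in F}$ of evaluated systems with true generalized equalities and belongings: $\mathrm{Inf}_{\mathcal D}\prod_fU_f\vDash\varphi[\bowtie_f\gamma_f]$ iff $\{g\in F:U_g\vDash\varphi[\gamma_g]\}\in\mathcal D$. A filter: family of subsets closed under finite intersections and supersets. -}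

module Defs where

open import Level using (Level; _⊔_; Lift; lift; lower) renaming (suc to lsuc; zero to lzero)
open import Data.Nat using (ℕ)
open import Data.Nat.Properties using () renaming (_≟_ to _≟ℕ_)
open import Data.Fin using (Fin)
open import Data.Product using (Σ; _×_; _,_)
open import Data.Sum using (_⊎_)
open import Relation.Nullary using (¬_; yes; no)
open import Relation.Binary.PropositionalEquality using (_≡_; refl)
open import Relation.Binary.Structures using (IsEquivalence)
open import Function.Bundles using (_⇔_)

-- Types: ι is the first-order type 0; so k is [0,…,0] with k+1 entries.

data Ty : Set where
  ι  : Ty
  so : ℕ → Ty

Tup : ℕ → Set → Set
Tup k A = Fin (Data.Nat.suc k) → A

-- τ(A):  0(A) = A (lifted),  so k (A) = P(A^{k+1}) as predicates
⟦_⟧ : Ty → Set → Set₁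
⟦ ι ⟧    A = Lift (lsuc lzero) A
⟦ so k ⟧ A = Tup k A → Set

record Sig : Set₁ where
  field
    Θ      : Ty → Set
    Θι     : Θ ι
    Θso    : Σ ℕ (λ k → Θ (so k))
    Const  : Ty → Set
    constΘ : ∀ {τ} → Const τ → Θ τ

module _ (S : Sig) where
  open Sig S

  data Term (τ : Ty) : Set where
    var : ℕ → Term τ
    con : Const τ → Term τ

  data Fm : Set where
    δF   : (τ : Ty) → .(Θ τ) → Term τ → Term τ → Fm
    εF   : (k : ℕ) → .(Θ (so k)) → (Fin (Data.Nat.suc k) → Term ι) → Term (so k) → Fm
    ¬F   : Fm → Fm
    _∧F_ : Fm → Fm → Fm
    _∨F_ : Fm → Fm → Fm
    _⇒F_ : Fm → Fm → Fm
    ∃F   : (τ : Ty) → .(Θ τ) → ℕ → Fm → Fm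
    ∀F   : (τ : Ty) → .(Θ τ) → ℕ → Fm → Fm

  -- structures (systems without the two inclusion laws)
  record Str (r : Level) : Set (lsuc (lsuc lzero ⊔ r)) where
    field
      A    : Set
      cst  : ∀ {τ} → Const τ → ⟦ τ ⟧ A
      eqv  : (τ : Ty) → .(Θ τ) → ⟦ τ ⟧ A → ⟦ τ ⟧ A → Set r
      mem  : (k : ℕ) → .(Θ (so k)) → Tup k A → (Tup k A → Set) → Set r

  record IsSystem {r : Level} (U : Str r) : Set (lsuc lzero ⊔ r) where
    open Str U
    field
      eqv-id  : (τ : Ty) .(θ : Θ τ) (x y : ⟦ τ ⟧ A) → x ≡ y → eqv τ θ x y
      mem-inc : (k : ℕ) .(θ : Θ (so k)) (p : Tup k A) (P : Tup k A → Set) → P p → mem k θ p P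

  record TrueGEB {r : Level} (U : Str r) : Set (lsuc lzero ⊔ r) where
    open Str U
    field
      equiv  : (τ : Ty) .(θ : Θ τ) → IsEquivalence (eqv τ θ)
      compat : (k : ℕ) .(θ : Θ (so k)) (x y : Tup k A) (u v : Tup k A → Set) →
               (∀ μ → eqv ι Θι (lift (x μ)) (lift (y μ))) → eqv (so k) θ u v →
               (mem k θ x u ⇔ mem k θ y v)

  Env : Set → Set₁
  Env X = (τ : Ty) → .(Θ τ) → ℕ → ⟦ τ ⟧ X

  upd : ∀ {X} → Env X → (τ : Ty) → ℕ → ⟦ τ ⟧ X → Env X
  upd γ ι n a ι θ m with m ≟ℕ n
  ... | yes _ = a
  ... | no  _ = γ ι θ m
  upd γ ι n a (so j) θ m = γ (so j) θ m
  upd γ (so k) n a ι θ m = γ ι θ m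
  upd γ (so k) n a (so j) θ m with k ≟ℕ j | m ≟ℕ n
  ... | yes refl | yes _ = a
  ... | _        | _     = γ (so j) θ m

  module _ {r : Level} (U : Str r) where
    open Str U

    evalT : Env A → (τ : Ty) → .(Θ τ) → Term τ → ⟦ τ ⟧ A
    evalT γ τ θ (var n) = γ τ θ n
    evalT γ τ θ (con c) = cst c

    Sat : Env A → Fm → Set (lsuc lzero ⊔ r)
    Sat γ (δF τ θ q s)  = Lift (lsuc lzero) (eqv τ θ (evalT γ τ θ q) (evalT γ τ θ s))
    Sat γ (εF k θ qs s) = Lift (lsuc lzero)
      (mem k θ (λ μ → lower (evalT γ ι Θι (qs μ))) (evalT γ (so k) θ s))
    Sat γ (¬F φ)    = ¬ Sat γ φ
    Sat γ (φ ∧F ψ)  = Sat γ φ × Sat γ ψ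
    Sat γ (φ ∨F ψ)  = Sat γ φ ⊎ Sat γ ψ
    Sat γ (φ ⇒F ψ)  = Sat γ φ → Sat γ ψ
    Sat γ (∃F τ θ n φ) = Σ (⟦ τ ⟧ A) λ a → Sat (upd γ τ n a) φ
    Sat γ (∀F τ θ n φ) = (a : ⟦ τ ⟧ A) → Sat (upd γ τ n a) φ

  -- Infra-D-products.  Subsets of F are predicates F → Set₁.

  module _ (F : Set) (D : (F → Set₁) → Set₁) (U : F → Str (lsuc lzero)) where
    open Str

    ΠA : Set
    ΠA = (f : F) → A (U f)

    _⟨_⟩ : ∀ {k} → (Tup k ΠA → Set) → (g : F) → Tup k (A (U g)) → Set
    P ⟨ g ⟩ = λ x → Σ (Tup k' ΠA) λ p → P p × (∀ μ → p μ g ≡ x μ)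
      where k' = _

    infCst : ∀ {τ} → Const τ → ⟦ τ ⟧ ΠA
    infCst {ι}    c = lift (λ f → lower (cst (U f) c))
    infCst {so k} c = λ p → ∀ f → cst (U f) c (λ μ → p μ f)

    infEqv : (τ : Ty) → .(Θ τ) → ⟦ τ ⟧ ΠA → ⟦ τ ⟧ ΠA → Set₂
    infEqv ι θ p q = Σ (F → Set₁) λ G → D G ×
      (∀ g → G g → eqv (U g) ι θ (lift (lower p g)) (lift (lower q g)))
    infEqv (so k) θ P Q = Σ (F → Set₁) λ G → D G ×
      (∀ g → G g → eqv (U g) (so k) θ (P ⟨ g ⟩) (Q ⟨ g ⟩))

    infMem : (k : ℕ) → .(Θ (so k)) → Tup k ΠA → (Tup k ΠA → Set) → Set₂
    infMem k θ p P = Σ (F → Set₁) λ G → D G ×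
      (∀ g → G g → mem (U g) k θ (λ μ → p μ g) (P ⟨ g ⟩))

    Inf : Str (lsuc (lsuc lzero))
    Inf = record { A = ΠA ; cst = infCst ; eqv = infEqv ; mem = infMem }

    cross : ((f : F) → Env (A (U f))) → Env ΠA
    cross γs ι      θ n = lift (λ f → lower (γs f ι θ n))
    cross γs (so k) θ n = λ p → ∀ f → γs f (so k) θ n (λ μ → p μ f)

  Infrafiltrated : (F : Set) → ((F → Set₁) → Set₁) → Fm → Set _
  Infrafiltrated F D φ =
    (U : F → Str (lsuc lzero)) → (∀ f → IsSystem (U f)) → (∀ f → TrueGEB (U f)) →
    (γs : (f : F) → Env (Str.A (U f))) →
    Sat (Inf F D U) (cross F D U γs) φ ⇔ D (λ g → Sat (U g) (γs g) φ)

-- a filter on F: closed under (binary, hence finite nonempty) intersections and supersets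
record IsFilter {F : Set} (D : (F → Set₁) → Set₁) : Set₂ where
  field
    ∩-closed : (G H : F → Set₁) → D G → D H → D (λ g → G g × H g)
    ⊇-closed : (G H : F → Set₁) → D G → (∀ g → G g → H g) → D H

module Submission where

-- Satisfaction of ψ ∧ ξ is the product of the satisfactions of ψ and ξ, both
-- in the infra-product (under the crossed evaluation) and in each factor.
-- Hence the infrafiltration of ψ ∧ ξ reduces to one general fact about
-- filters: a filter contains the intersection G ∩ H exactly when it
-- contains both G and H (closure under intersections gives one direction,
-- closure under supersets the other).  The theorem is then the product of
-- the two given equivalences, composed with this filter equivalence.

open import Defs
open import Data.Product using (_×_; _,_; proj₁; proj₂)
open import Data.Product.Function.NonDependent.Propositional using (_×-⇔_)
open import Function.Bundles using (_⇔_; mk⇔)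
open import Function.Construct.Composition using (_⇔-∘_)

∩∈filter⇔ : {F : Set} {D : (F → Set₁) → Set₁} → IsFilter D →
            (G H : F → Set₁) → (D G × D H) ⇔ D (λ g → G g × H g)
∩∈filter⇔ filt G H =
  mk⇔ (λ { (dG , dH) → ∩-closed G H dG dH })
      (λ d → ⊇-closed _ G d (λ _ → proj₁) , ⊇-closed _ H d (λ _ → proj₂))
  where open IsFilter filt

lemma6 : (S : Sig) (F : Set) (D : (F → Set₁) → Set₁) → IsFilter D →
    (ψ ξ : Fm S) → Infrafiltrated S F D ψ → Infrafiltrated S F D ξ →
    Infrafiltrated S F D (_∧F_ {S} ψ ξ)
lemma6 S F D filt ψ ξ hψ hξ U sys geb γs =
  ∩∈filter⇔ filt (λ g → Sat S (U g) (γs g) ψ) (λ g → Sat S (U g) (γs g) ξ)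
    ⇔-∘ (hψ U sys geb γs ×-⇔ hξ U sys geb γs)
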